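{- Let $a,b$ be relatively prime positive integers and $k$ a positive integer. For every $t\in\mathbb{Z}$, \[R_{\{a,b\}}(t+k(a+b))=R_{\{a,b\}}(t)-\sum_{j=0}^{k-1}\left[\delta_{\mathbb{Z}}\!\left(\tfrac{t+jb}{a}\right)+\delta_{\mathbb{Z}}\!\left(\tfrac{t+ja}{b}\right)\right]+\frac ka+\frac kb.\]
   Context: $R_{\{a,b\}}(t):=S_{(b;a)}(t)+S_{(a;b)}(t)$, where for an integer $c\ge1$ and a positive integer $e$ coprime to $c$, $S_{(e;c)}(n)=\frac1c\sum_{j=1}^{c-1}\frac{\xi_c^{jn}}{1-\xi_c^{je}}$ with $\xi_c=e^{2\pi i/c}$ (an empty sum, $0$, when $c=1$). $\delta_{\mathbb{Z}}(x)=1$ if $x\in\mathbb{Z}$ and $0$ otherwise. -}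

module Defs where

open import Level using (Level; suc; _⊔_)
open import Data.Nat as ℕ using (ℕ; zero; _<_)
import Data.Nat.Base
open import Data.Integer as ℤ using (ℤ; +_; -[1+_])
open import Data.Integer.Divisibility.Signed using (_∣_; _∣?_)
open import Data.Product using (_×_)
open import Relation.Nullary using (¬_; does)
open import Relation.Binary.PropositionalEquality using (_≡_)
open import Data.Bool using (if_then_else_)
open import Algebra.Bundles using (CommutativeRing)
import Algebra.Bundles
import Algebra.Definitions.RawSemiring as RSDefs

-- A field of characteristic zero: a commutative ring (setoid equality ≈)
-- with 1 ≉ 0 (implied by char0 at n = 1), an inverse operation that is a
-- genuine inverse on every nonzero element, and n·1 ≉ 0 for all n ≠ 0.
record CharZeroField (c ℓ : Level) : Set (suc (c ⊔ ℓ)) where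
  field
    cring : CommutativeRing c ℓ
  open CommutativeRing cring public
  open RSDefs (Algebra.Bundles.Semiring.rawSemiring semiring) public using (_^_) renaming (_×_ to _·_)
  field
    inv       : Carrier → Carrier
    inv-right : ∀ x → ¬ (x ≈ 0#) → x * inv x ≈ 1#
    char0     : ∀ (n : ℕ) → ¬ (n ≡ 0) → ¬ ((n · 1#) ≈ 0#)

module _ {c ℓ : Level} (K : CharZeroField c ℓ) where
  open CharZeroField K

  ι : ℕ → Carrier
  ι n = n · 1#

  IsPrimitiveRoot : Carrier → ℕ → Set ℓ
  IsPrimitiveRoot ζ m = ((ζ ^ m) ≈ 1#) Data.Product.× (∀ i → 0 < i → i < m → ¬ ((ζ ^ i) ≈ 1#))

  zpow : Carrier → ℤ → Carrier
  zpow x (+ n)    = x ^ n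
  zpow x -[1+ n ] = inv x ^ ℕ.suc n

  -- Σ_{j = lo}^{lo + len - 1} f j
  sumFrom : ℕ → ℕ → (ℕ → Carrier) → Carrier
  sumFrom lo zero      f = 0#
  sumFrom lo (ℕ.suc n) f = f lo + sumFrom (ℕ.suc lo) n f

  -- Fourier–Dedekind sum S_(e;m)(n) = (1/m) Σ_{j=1}^{m-1} ζ^{jn} / (1 - ζ^{je}),
  -- where ζ plays the role of ξ_m (a primitive m-th root of unity).
  S : (ζ : Carrier) (e m : ℕ) (n : ℤ) → Carrier
  S ζ e m n = inv (ι m) * sumFrom 1 (m ℕ.∸ 1)
                (λ j → zpow ζ (+ j ℤ.* n) * inv (1# - (ζ ^ (j ℕ.* e))))

  R : (ζa ζb : Carrier) (a b : ℕ) (t : ℤ) → Carrier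
  R ζa ζb a b t = S ζa b a t + S ζb a b t

  -- δ_ℤ(x / d) as an element of K: 1 if d ∣ x, else 0.
  δdiv : ℤ → ℕ → Carrier
  δdiv x d = if does ((+ d) ∣? x) then 1# else 0#

-- For a primitive c-th root of unity ζ, the sum Σ_{j=0}^{c-1} ζ^{jn} equals c if c ∣ n and 0 otherwise.
-- Since ζ^{j(n+e)}/(1-ζ^{je}) = ζ^{jn}/(1-ζ^{je}) - ζ^{jn}, this gives the recurrence
-- S_(e;c)(n+e) = S_(e;c)(n) - δ_ℤ(n/c) + 1/c, which iterates to a formula for S_(e;c)(n+ke).
-- As S_(b;a) has period a and S_(a;b) has period b, the argument t + k(a+b) can be replaced by t + kb
-- and t + ka respectively, and the two iterated recurrences add up to the theorem.
module Submission where

open import Defs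
open import Level using (Level)
open import Function using (_∘_)
open import Function.Bundles using (_⇔_; mk⇔; Equivalence)
open import Data.Bool using (if_then_else_)
open import Data.List using (_∷_; [])
open import Data.Maybe using (Maybe; just; nothing)
open import Data.Product using (proj₁; proj₂)
open import Data.Sum using (inj₁; inj₂)
open import Data.Nat as ℕ using (ℕ; zero; suc; _<_; _≤_; _%_; _/_)
import Data.Nat.Properties as ℕ
import Data.Nat.Divisibility as ℕ
open import Data.Nat.Coprimality as Coprimality using (Coprime; coprime-divisor)
open import Data.Nat.DivMod using (m≡m%n+[m/n]*n; m%n<n)
import Data.Nat.Tactic.RingSolver as ℕ-Solver
open import Data.Integer as ℤ using (ℤ; +_; -[1+_]; 0ℤ; 1ℤ)
import Data.Integer.Properties as ℤ
open import Data.Integer.Divisibility.Signed using (_∣_; _∣?_; divides)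
import Data.Integer.Divisibility.Signed as ℤ
import Data.Integer.Tactic.RingSolver as ℤ-Solver
open import Relation.Binary.PropositionalEquality as ≡ using (_≡_)
open import Relation.Nullary using (¬_; Dec; yes; no; contradiction)
open import Relation.Nullary.Decidable using (dec-true; dec-false)
open import Algebra.Bundles using (CommutativeRing)
import Algebra.Solver.Ring
open import Algebra.Solver.Ring.AlmostCommutativeRing
  using (fromCommutativeRing; _-Raw-AlmostCommutative⟶_)

module IntegerCoefficientSolver {r ℓ} (R : CommutativeRing r ℓ) where
  open CommutativeRing R
  open import Algebra.Properties.Semiring.Mult.TCOptimised semiring using (×-homo-+; ×1-homo-*)
    renaming (_×_ to _·_)
  open import Algebra.Properties.Ring ring using (-‿distribˡ-*; -‿distribʳ-*; -0#≈0#)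
  open import Algebra.Properties.AbelianGroup +-abelianGroup
    using (⁻¹-∙-comm; ⁻¹-involutive; xyx⁻¹≈y; ⁻¹-anti-homo‿-)
  open import Relation.Binary.Reasoning.Setoid setoid

  -- The optimised multiplication makes fromℤ 1ℤ reduce to 1# (not 1# + 0#), so solver constants
  -- con 1ℤ and con 0ℤ match the ring's 1# and 0# definitionally.
  fromℤ : ℤ → Carrier
  fromℤ (+ n)    = n · 1#
  fromℤ -[1+ n ] = - (suc n · 1#)

  fromℤ-neg : ∀ x → fromℤ (ℤ.- x) ≈ - fromℤ x
  fromℤ-neg (+ zero)   = sym -0#≈0#
  fromℤ-neg (+ suc n)  = refl
  fromℤ-neg -[1+ n ]   = sym (⁻¹-involutive _)

  fromℤ-⊖-≥ : ∀ {m n} → n ≤ m → fromℤ (m ℤ.⊖ n) ≈ m · 1# - n · 1#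
  fromℤ-⊖-≥ {m} {n} n≤m = begin
    fromℤ (m ℤ.⊖ n)                 ≡⟨ ≡.cong fromℤ (ℤ.⊖-≥ n≤m) ⟩
    (m ℕ.∸ n) · 1#                   ≈⟨ xyx⁻¹≈y (n · 1#) _ ⟨
    n · 1# + (m ℕ.∸ n) · 1# - n · 1# ≈⟨ +-congʳ (×-homo-+ 1# n (m ℕ.∸ n)) ⟨
    (n ℕ.+ (m ℕ.∸ n)) · 1# - n · 1#  ≡⟨ ≡.cong (λ k → k · 1# - n · 1#) (ℕ.m+[n∸m]≡n n≤m) ⟩
    m · 1# - n · 1#                  ∎

  fromℤ-⊖ : ∀ m n → fromℤ (m ℤ.⊖ n) ≈ m · 1# - n · 1#
  fromℤ-⊖ m n with ℕ.≤-total n m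
  ... | inj₁ n≤m = fromℤ-⊖-≥ n≤m
  ... | inj₂ m≤n = begin
    fromℤ (m ℤ.⊖ n)           ≡⟨ ≡.cong fromℤ (ℤ.⊖-swap m n) ⟩
    fromℤ (ℤ.- (n ℤ.⊖ m))     ≈⟨ fromℤ-neg (n ℤ.⊖ m) ⟩
    - fromℤ (n ℤ.⊖ m)         ≈⟨ -‿cong (fromℤ-⊖-≥ m≤n) ⟩
    - (n · 1# - m · 1#)       ≈⟨ ⁻¹-anti-homo‿- _ _ ⟩
    m · 1# - n · 1#           ∎

  fromℤ-+ : ∀ x y → fromℤ (x ℤ.+ y) ≈ fromℤ x + fromℤ y
  fromℤ-+ (+ m)    (+ n)    = ×-homo-+ 1# m n
  fromℤ-+ (+ m)    -[1+ n ] = fromℤ-⊖ m (suc n)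
  fromℤ-+ -[1+ m ] (+ n)    = trans (fromℤ-⊖ n (suc m)) (+-comm _ _)
  fromℤ-+ -[1+ m ] -[1+ n ] = begin
    - (suc (suc (m ℕ.+ n)) · 1#)    ≡⟨ ≡.cong (λ k → - (suc k · 1#)) (ℕ.+-suc m n) ⟨
    - ((suc m ℕ.+ suc n) · 1#)      ≈⟨ -‿cong (×-homo-+ 1# (suc m) (suc n)) ⟩
    - (suc m · 1# + suc n · 1#)     ≈⟨ ⁻¹-∙-comm _ _ ⟨
    - (suc m · 1#) + - (suc n · 1#) ∎

  fromℤ-+* : ∀ m y → fromℤ (+ m ℤ.* y) ≈ m · 1# * fromℤ y
  fromℤ-+* m (+ n)    = trans (reflexive (≡.cong fromℤ (≡.sym (ℤ.pos-* m n)))) (×1-homo-* m n)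
  fromℤ-+* m -[1+ n ] = begin
    fromℤ (+ m ℤ.* -[1+ n ])           ≡⟨ ≡.cong fromℤ (ℤ.neg-distribʳ-* (+ m) (+ suc n)) ⟨
    fromℤ (ℤ.- (+ m ℤ.* + suc n))      ≈⟨ fromℤ-neg (+ m ℤ.* + suc n) ⟩
    - fromℤ (+ m ℤ.* + suc n)          ≈⟨ -‿cong (fromℤ-+* m (+ suc n)) ⟩
    - (m · 1# * suc n · 1#)            ≈⟨ -‿distribʳ-* _ _ ⟩
    m · 1# * - (suc n · 1#)            ∎

  fromℤ-* : ∀ x y → fromℤ (x ℤ.* y) ≈ fromℤ x * fromℤ y
  fromℤ-* (+ m)    y = fromℤ-+* m y
  fromℤ-* -[1+ m ] y = begin
    fromℤ (-[1+ m ] ℤ.* y)             ≡⟨ ≡.cong fromℤ (ℤ.neg-distribˡ-* (+ suc m) y) ⟨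
    fromℤ (ℤ.- (+ suc m ℤ.* y))        ≈⟨ fromℤ-neg (+ suc m ℤ.* y) ⟩
    - fromℤ (+ suc m ℤ.* y)            ≈⟨ -‿cong (fromℤ-+* (suc m) y) ⟩
    - (suc m · 1# * fromℤ y)           ≈⟨ -‿distribˡ-* _ _ ⟩
    - (suc m · 1#) * fromℤ y           ∎

  fromℤ-homomorphism : ℤ.+-*-rawRing -Raw-AlmostCommutative⟶ fromCommutativeRing R
  fromℤ-homomorphism = record
    { ⟦_⟧ = fromℤ ; +-homo = fromℤ-+ ; *-homo = fromℤ-* ; -‿homo = fromℤ-neg
    ; 0-homo = refl ; 1-homo = refl }

  private
    fromℤ-≟ : ∀ x y → Maybe (fromℤ x ≈ fromℤ y)
    fromℤ-≟ x y with x ℤ.≟ y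
    ... | yes ≡.refl = just refl
    ... | no _       = nothing

  open Algebra.Solver.Ring ℤ.+-*-rawRing (fromCommutativeRing R) fromℤ-homomorphism fromℤ-≟ public
    using (solve; _:=_; _:+_; _:*_; _:-_; con)

infix 4 _≡_mod_
record _≡_mod_ (x y : ℤ) (c : ℕ) : Set where
  constructor ≡-mod
  field ∣-difference : + c ∣ x ℤ.- y

module _ {c : ℕ} where

  private
    -[x-y]≡y-x : ∀ x y → ℤ.- (x ℤ.- y) ≡ y ℤ.- x
    -[x-y]≡y-x = ℤ-Solver.solve-∀
    [x+z]-[y+z]≡x-y : ∀ x y z → (x ℤ.+ z) ℤ.- (y ℤ.+ z) ≡ x ℤ.- y
    [x+z]-[y+z]≡x-y = ℤ-Solver.solve-∀
    z*x-z*y≡z*[x-y] : ∀ x y z → z ℤ.* x ℤ.- z ℤ.* y ≡ z ℤ.* (x ℤ.- y)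
    z*x-z*y≡z*[x-y] = ℤ-Solver.solve-∀
    [x-y]+y≡x : ∀ x y → (x ℤ.- y) ℤ.+ y ≡ x
    [x-y]+y≡x = ℤ-Solver.solve-∀
    [x+k[z+y]]-[x+ky]≡kz : ∀ x k y z → (x ℤ.+ k ℤ.* (z ℤ.+ y)) ℤ.- (x ℤ.+ k ℤ.* y) ≡ k ℤ.* z
    [x+k[z+y]]-[x+ky]≡kz = ℤ-Solver.solve-∀

  ≡-mod-refl : ∀ x → x ≡ x mod c
  ≡-mod-refl x = ≡-mod (divides 0ℤ (ℤ.+-inverseʳ x))

  ≡-mod-sym : ∀ {x y} → x ≡ y mod c → y ≡ x mod c
  ≡-mod-sym {x} {y} (≡-mod c∣x-y) = ≡-mod (≡.subst (+ c ∣_) (-[x-y]≡y-x x y) (ℤ.∣m⇒∣-m c∣x-y))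

  ≡-mod-trans : ∀ {x y z} → x ≡ y mod c → y ≡ z mod c → x ≡ z mod c
  ≡-mod-trans {x} {y} {z} (≡-mod c∣x-y) (≡-mod c∣y-z) =
    ≡-mod (≡.subst (+ c ∣_) (ℤ.+-minus-telescope x y z) (ℤ.∣m∣n⇒∣m+n c∣x-y c∣y-z))

  ≡-mod-+ʳ : ∀ {x y} z → x ≡ y mod c → x ℤ.+ z ≡ y ℤ.+ z mod c
  ≡-mod-+ʳ {x} {y} z (≡-mod c∣x-y) = ≡-mod (≡.subst (+ c ∣_) (≡.sym ([x+z]-[y+z]≡x-y x y z)) c∣x-y)

  ≡-mod-*ˡ : ∀ {x y} z → x ≡ y mod c → z ℤ.* x ≡ z ℤ.* y mod c
  ≡-mod-*ˡ {x} {y} z (≡-mod c∣x-y) =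
    ≡-mod (≡.subst (+ c ∣_) (≡.sym (z*x-z*y≡z*[x-y] x y z)) (ℤ.∣n⇒∣m*n z c∣x-y))

  ∣⇒≡0 : ∀ {x} → + c ∣ x → x ≡ 0ℤ mod c
  ∣⇒≡0 {x} = ≡-mod ∘ ≡.subst (+ c ∣_) (≡.sym (ℤ.+-identityʳ x))

  ≡-mod-∣ : ∀ {x y} → x ≡ y mod c → + c ∣ y → + c ∣ x
  ≡-mod-∣ {x} {y} (≡-mod c∣x-y) c∣y = ≡.subst (+ c ∣_) ([x-y]+y≡x x y) (ℤ.∣m∣n⇒∣m+n c∣x-y c∣y)

  x+k[c+y]≡x+ky : ∀ x k y → x ℤ.+ k ℤ.* (+ c ℤ.+ y) ≡ x ℤ.+ k ℤ.* y mod c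
  x+k[c+y]≡x+ky x k y =
    ≡-mod (≡.subst (+ c ∣_) (≡.sym ([x+k[z+y]]-[x+ky]≡kz x k y (+ c))) (ℤ.∣n⇒∣m*n k ℤ.∣-refl))

module FieldProperties {κ ℓ} (K : CharZeroField κ ℓ) where
  open CharZeroField K
  open import Algebra.Properties.Group +-group using (x∙y⁻¹≈ε⇒x≈y)
  open import Relation.Binary.Reasoning.Setoid setoid
  open IntegerCoefficientSolver cring using (solve; _:=_; _:*_)

  1#≉0# : ¬ 1# ≈ 0#
  1#≉0# 1≈0 = char0 1 (λ ()) (trans (+-identityʳ 1#) 1≈0)

  x-y≈0⇒x≈y : ∀ {x y} → x - y ≈ 0# → x ≈ y
  x-y≈0⇒x≈y = x∙y⁻¹≈ε⇒x≈y _ _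

  x≉0∧x*y≈0⇒y≈0 : ∀ {x y} → ¬ x ≈ 0# → x * y ≈ 0# → y ≈ 0#
  x≉0∧x*y≈0⇒y≈0 {x} {y} x≉0 x*y≈0 = begin
    y               ≈⟨ *-identityˡ y ⟨
    1# * y          ≈⟨ *-congʳ (inv-right x x≉0) ⟨
    (x * inv x) * y ≈⟨ solve 3 (λ x x⁻¹ y → (x :* x⁻¹) :* y := x⁻¹ :* (x :* y)) refl x (inv x) y ⟩
    inv x * (x * y) ≈⟨ *-congˡ x*y≈0 ⟩
    inv x * 0#      ≈⟨ zeroʳ (inv x) ⟩
    0#              ∎

  1#^n≈1# : ∀ n → 1# ^ n ≈ 1#
  1#^n≈1# zero    = refl
  1#^n≈1# (suc n) = trans (*-identityˡ (1# ^ n)) (1#^n≈1# n)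

module DivisibilityIndicator {κ ℓ} (K : CharZeroField κ ℓ) where
  open CharZeroField K

  δdiv-∣ : ∀ {x d} → + d ∣ x → δdiv K x d ≡ 1#
  δdiv-∣ {x} {d} d∣x = ≡.cong (if_then 1# else 0#) (dec-true (+ d ∣? x) d∣x)

  δdiv-∤ : ∀ {x d} → ¬ + d ∣ x → δdiv K x d ≡ 0#
  δdiv-∤ {x} {d} d∤x = ≡.cong (if_then 1# else 0#) (dec-false (+ d ∣? x) d∤x)

module FiniteSums {κ ℓ} (K : CharZeroField κ ℓ) where
  open CharZeroField K
  open import Algebra.Properties.CommutativeSemigroup +-commutativeSemigroup using (interchange)
  open import Algebra.Properties.AbelianGroup +-abelianGroup using (⁻¹-∙-comm)
  open import Relation.Binary.Reasoning.Setoid setoid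
  open IntegerCoefficientSolver cring using (solve; _:=_; _:+_; _:*_; _:-_; con)

  sumFrom-cong : ∀ lo n {f g : ℕ → Carrier} →
                 (∀ j → lo ≤ j → j < lo ℕ.+ n → f j ≈ g j) → sumFrom K lo n f ≈ sumFrom K lo n g
  sumFrom-cong lo zero    f≈g = refl
  sumFrom-cong lo (suc n) f≈g = +-cong
    (f≈g lo ℕ.≤-refl (ℕ.m<m+n lo (ℕ.s≤s ℕ.z≤n)))
    (sumFrom-cong (suc lo) n λ j lo<j j<lo+1+n →
      f≈g j (ℕ.<⇒≤ lo<j) (≡.subst (j <_) (≡.sym (ℕ.+-suc lo n)) j<lo+1+n))

  sumFrom-distrib-+ : ∀ lo n (f g : ℕ → Carrier) →
                      sumFrom K lo n (λ j → f j + g j) ≈ sumFrom K lo n f + sumFrom K lo n g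
  sumFrom-distrib-+ lo zero    f g = sym (+-identityʳ 0#)
  sumFrom-distrib-+ lo (suc n) f g =
    trans (+-congˡ (sumFrom-distrib-+ (suc lo) n f g)) (interchange _ _ _ _)

  sumFrom-distrib-minus : ∀ lo n (f g : ℕ → Carrier) →
                          sumFrom K lo n (λ j → f j - g j) ≈ sumFrom K lo n f - sumFrom K lo n g
  sumFrom-distrib-minus lo zero    f g = sym (-‿inverseʳ 0#)
  sumFrom-distrib-minus lo (suc n) f g =
    trans (+-congˡ (sumFrom-distrib-minus (suc lo) n f g))
          (trans (interchange _ _ _ _) (+-congˡ (⁻¹-∙-comm _ _)))

  sumFrom-suc : ∀ lo n (f : ℕ → Carrier) → sumFrom K lo (suc n) f ≈ sumFrom K lo n f + f (lo ℕ.+ n)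
  sumFrom-suc lo zero    f =
    trans (+-comm _ _) (+-congˡ (reflexive (≡.cong f (≡.sym (ℕ.+-identityʳ lo)))))
  sumFrom-suc lo (suc n) f = begin
    f lo + sumFrom K (suc lo) (suc n) f               ≈⟨ +-congˡ (sumFrom-suc (suc lo) n f) ⟩
    f lo + (sumFrom K (suc lo) n f + f (suc lo ℕ.+ n)) ≈⟨ +-assoc _ _ _ ⟨
    sumFrom K lo (suc n) f + f (suc lo ℕ.+ n)
      ≡⟨ ≡.cong (λ i → sumFrom K lo (suc n) f + f i) (ℕ.+-suc lo n) ⟨
    sumFrom K lo (suc n) f + f (lo ℕ.+ suc n)          ∎

  sumFrom-1# : ∀ lo n → sumFrom K lo n (λ _ → 1#) ≈ ι K n
  sumFrom-1# lo zero    = refl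
  sumFrom-1# lo (suc n) = +-congˡ (sumFrom-1# (suc lo) n)

  geometric-sum : ∀ u n → (u - 1#) * sumFrom K 0 n (u ^_) ≈ u ^ n - 1#
  geometric-sum u zero    = trans (zeroʳ _) (sym (-‿inverseʳ 1#))
  geometric-sum u (suc n) = begin
    (u - 1#) * sumFrom K 0 (suc n) (u ^_)                 ≈⟨ *-congˡ (sumFrom-suc 0 n (u ^_)) ⟩
    (u - 1#) * (sumFrom K 0 n (u ^_) + u ^ n)             ≈⟨ distribˡ _ _ _ ⟩
    (u - 1#) * sumFrom K 0 n (u ^_) + (u - 1#) * u ^ n    ≈⟨ +-congʳ (geometric-sum u n) ⟩
    (u ^ n - 1#) + (u - 1#) * u ^ n
      ≈⟨ solve 2 (λ u uⁿ → (uⁿ :- con 1ℤ) :+ (u :- con 1ℤ) :* uⁿ := u :* uⁿ :- con 1ℤ) refl u (u ^ n) ⟩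
    u * u ^ n - 1#                                        ∎

module RootOfUnity {κ ℓ} (K : CharZeroField κ ℓ) (ζ : CharZeroField.Carrier K) (c′ : ℕ)
                   (ζ-primitive : IsPrimitiveRoot K ζ (suc c′)) where
  open CharZeroField K
  open FieldProperties K
  open FiniteSums K
  open DivisibilityIndicator K
  open import Algebra.Properties.Semiring.Exp semiring using (^-homo-*; ^-assocʳ; ^-congˡ)
  open import Relation.Binary.Reasoning.Setoid setoid
  open IntegerCoefficientSolver cring using (solve; _:=_; _:*_)

  c : ℕ
  c = suc c′

  ζ^[n+q*c]≈ζ^n : ∀ n q → ζ ^ (n ℕ.+ q ℕ.* c) ≈ ζ ^ n
  ζ^[n+q*c]≈ζ^n n q = begin
    ζ ^ (n ℕ.+ q ℕ.* c)     ≈⟨ ^-homo-* ζ n (q ℕ.* c) ⟩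
    ζ ^ n * ζ ^ (q ℕ.* c)   ≡⟨ ≡.cong (λ i → ζ ^ n * ζ ^ i) (ℕ.*-comm q c) ⟩
    ζ ^ n * ζ ^ (c ℕ.* q)   ≈⟨ *-congˡ (^-assocʳ ζ c q) ⟨
    ζ ^ n * (ζ ^ c) ^ q     ≈⟨ *-congˡ (trans (^-congˡ q (proj₁ ζ-primitive)) (1#^n≈1# q)) ⟩
    ζ ^ n * 1#              ≈⟨ *-identityʳ (ζ ^ n) ⟩
    ζ ^ n                   ∎

  ζ^m≈1⇒c∣m : ∀ m → ζ ^ m ≈ 1# → c ℕ.∣ m
  ζ^m≈1⇒c∣m m ζ^m≈1 with m % c ℕ.≟ 0
  ... | yes m%c≡0 = ℕ.m%n≡0⇒n∣m m c m%c≡0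
  ... | no  m%c≢0 = contradiction ζ^[m%c]≈1 (proj₂ ζ-primitive (m % c) (ℕ.n≢0⇒n>0 m%c≢0) (m%n<n m c))
    where
    ζ^[m%c]≈1 : ζ ^ (m % c) ≈ 1#
    ζ^[m%c]≈1 = trans (sym (ζ^[n+q*c]≈ζ^n (m % c) (m / c)))
                      (trans (reflexive (≡.cong (ζ ^_) (≡.sym (m≡m%n+[m/n]*n m c)))) ζ^m≈1)

  ζ^[n+d]≈ζ^n : ∀ n {d} → c ℕ.∣ d → ζ ^ (n ℕ.+ d) ≈ ζ ^ n
  ζ^[n+d]≈ζ^n n (ℕ.divides q ≡.refl) = ζ^[n+q*c]≈ζ^n n q

  ^-cong-≥ : ∀ {m n} → n ≤ m → + m ≡ + n mod c → ζ ^ m ≈ ζ ^ n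
  ^-cong-≥ {m} {n} n≤m (≡-mod c∣m-n) = begin
    ζ ^ m                   ≡⟨ ≡.cong (ζ ^_) (ℕ.m+[n∸m]≡n n≤m) ⟨
    ζ ^ (n ℕ.+ (m ℕ.∸ n))   ≈⟨ ζ^[n+d]≈ζ^n n (ℤ.∣⇒∣ᵤ c∣m∸n) ⟩
    ζ ^ n                   ∎
    where
    c∣m∸n : + c ∣ + (m ℕ.∸ n)
    c∣m∸n = ≡.subst (+ c ∣_) (≡.trans (ℤ.[+m]-[+n]≡m⊖n m n) (ℤ.⊖-≥ n≤m)) c∣m-n

  ^-cong : ∀ {m n} → + m ≡ + n mod c → ζ ^ m ≈ ζ ^ n
  ^-cong {m} {n} m≡n with ℕ.≤-total n m
  ... | inj₁ n≤m = ^-cong-≥ n≤m m≡n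
  ... | inj₂ m≤n = sym (^-cong-≥ m≤n (≡-mod-sym m≡n))

  inv-ζ≈ζ^c′ : inv ζ ≈ ζ ^ c′
  inv-ζ≈ζ^c′ = begin
    inv ζ                ≈⟨ *-identityʳ (inv ζ) ⟨
    inv ζ * 1#           ≈⟨ *-congˡ (proj₁ ζ-primitive) ⟨
    inv ζ * (ζ * ζ ^ c′)
      ≈⟨ solve 3 (λ ζ⁻¹ ζ ζᶜ′ → ζ⁻¹ :* (ζ :* ζᶜ′) := (ζ :* ζ⁻¹) :* ζᶜ′) refl (inv ζ) ζ (ζ ^ c′) ⟩
    (ζ * inv ζ) * ζ ^ c′ ≈⟨ *-congʳ (inv-right ζ ζ≉0) ⟩
    1# * ζ ^ c′          ≈⟨ *-identityˡ (ζ ^ c′) ⟩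
    ζ ^ c′               ∎
    where
    ζ≉0 : ¬ ζ ≈ 0#
    ζ≉0 ζ≈0 = 1#≉0# (trans (sym (proj₁ ζ-primitive)) (trans (*-congʳ ζ≈0) (zeroˡ _)))

  residue : ℤ → ℕ
  residue (+ n)    = n
  residue -[1+ n ] = c′ ℕ.* suc n

  residue-≡ : ∀ x → + residue x ≡ x mod c
  residue-≡ (+ n)    = ≡-mod-refl (+ n)
  residue-≡ -[1+ n ] =
    ≡-mod (divides (+ suc n) (≡.trans (≡.cong +_ c′[1+n]+[1+n]≡[1+n]c) (ℤ.pos-* (suc n) c)))
    where
    c′[1+n]+[1+n]≡[1+n]c : c′ ℕ.* suc n ℕ.+ suc n ≡ suc n ℕ.* suc c′
    c′[1+n]+[1+n]≡[1+n]c = ℕ-Solver.solve (c′ ∷ n ∷ [])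

  zpow≈ζ^residue : ∀ x → zpow K ζ x ≈ ζ ^ residue x
  zpow≈ζ^residue (+ n)    = refl
  zpow≈ζ^residue -[1+ n ] = trans (^-congˡ (suc n) inv-ζ≈ζ^c′) (^-assocʳ ζ c′ (suc n))

  zpow≈ζ^ : ∀ {x} m → + m ≡ x mod c → zpow K ζ x ≈ ζ ^ m
  zpow≈ζ^ {x} m m≡x = trans (zpow≈ζ^residue x) (^-cong (≡-mod-trans (residue-≡ x) (≡-mod-sym m≡x)))

  zpow-cong : ∀ {x y} → x ≡ y mod c → zpow K ζ x ≈ zpow K ζ y
  zpow-cong {x} {y} x≡y = trans (zpow≈ζ^ (residue y) (≡-mod-trans (residue-≡ y) (≡-mod-sym x≡y)))
                                (sym (zpow≈ζ^residue y))

  zpow-+ : ∀ x m → zpow K ζ (x ℤ.+ + m) ≈ zpow K ζ x * ζ ^ m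
  zpow-+ x m = begin
    zpow K ζ (x ℤ.+ + m)        ≈⟨ zpow≈ζ^ (residue x ℕ.+ m) r+m≡x+m ⟩
    ζ ^ (residue x ℕ.+ m)       ≈⟨ ^-homo-* ζ (residue x) m ⟩
    ζ ^ residue x * ζ ^ m       ≈⟨ *-congʳ (zpow≈ζ^residue x) ⟨
    zpow K ζ x * ζ ^ m          ∎
    where
    r+m≡x+m : + (residue x ℕ.+ m) ≡ x ℤ.+ + m mod c
    r+m≡x+m = ≡.subst (_≡ x ℤ.+ + m mod c) (≡.sym (ℤ.pos-+ (residue x) m)) (≡-mod-+ʳ (+ m) (residue-≡ x))

  zpow-* : ∀ j x → zpow K ζ (+ j ℤ.* x) ≈ (ζ ^ residue x) ^ j
  zpow-* j x = begin
    zpow K ζ (+ j ℤ.* x)        ≈⟨ zpow≈ζ^ (j ℕ.* residue x) jr≡jx ⟩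
    ζ ^ (j ℕ.* residue x)       ≡⟨ ≡.cong (ζ ^_) (ℕ.*-comm j (residue x)) ⟩
    ζ ^ (residue x ℕ.* j)       ≈⟨ ^-assocʳ ζ (residue x) j ⟨
    (ζ ^ residue x) ^ j         ∎
    where
    jr≡jx : + (j ℕ.* residue x) ≡ + j ℤ.* x mod c
    jr≡jx = ≡.subst (_≡ + j ℤ.* x mod c) (≡.sym (ℤ.pos-* j (residue x))) (≡-mod-*ˡ (+ j) (residue-≡ x))

  ζ^residue≈1⇔c∣ : ∀ x → (ζ ^ residue x ≈ 1#) ⇔ (+ c ∣ x)
  ζ^residue≈1⇔c∣ x = mk⇔ to from
    where
    to : ζ ^ residue x ≈ 1# → + c ∣ x
    to ζʳ≈1 = ≡-mod-∣ (≡-mod-sym (residue-≡ x)) (ℤ.∣ᵤ⇒∣ (ζ^m≈1⇒c∣m (residue x) ζʳ≈1))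
    from : + c ∣ x → ζ ^ residue x ≈ 1#
    from c∣x = ^-cong (≡-mod-trans (residue-≡ x) (∣⇒≡0 c∣x))

  character-sum : ∀ x → sumFrom K 0 c (λ j → zpow K ζ (+ j ℤ.* x)) ≈ ι K c * δdiv K x c
  character-sum x = trans (sumFrom-cong 0 c (λ j _ _ → zpow-* j x)) (sum-of-powers (+ c ∣? x))
    where
    u : Carrier
    u = ζ ^ residue x
    sum-of-powers : (c∣?x : Dec (+ c ∣ x)) → sumFrom K 0 c (u ^_) ≈ ι K c * δdiv K x c
    sum-of-powers (yes c∣x) = begin
      sumFrom K 0 c (u ^_)        ≈⟨ sumFrom-cong 0 c (λ j _ _ → trans (^-congˡ j u≈1) (1#^n≈1# j)) ⟩
      sumFrom K 0 c (λ _ → 1#)    ≈⟨ sumFrom-1# 0 c ⟩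
      ι K c                       ≈⟨ *-identityʳ (ι K c) ⟨
      ι K c * 1#                  ≡⟨ ≡.cong (ι K c *_) (δdiv-∣ c∣x) ⟨
      ι K c * δdiv K x c          ∎
      where
      u≈1 : u ≈ 1#
      u≈1 = Equivalence.from (ζ^residue≈1⇔c∣ x) c∣x
    sum-of-powers (no c∤x) = begin
      sumFrom K 0 c (u ^_)        ≈⟨ x≉0∧x*y≈0⇒y≈0 u-1≉0 (trans (geometric-sum u c) uᶜ-1≈0) ⟩
      0#                          ≈⟨ zeroʳ (ι K c) ⟨
      ι K c * 0#                  ≡⟨ ≡.cong (ι K c *_) (δdiv-∤ c∤x) ⟨
      ι K c * δdiv K x c          ∎
      where
      u-1≉0 : ¬ u - 1# ≈ 0#
      u-1≉0 = c∤x ∘ Equivalence.to (ζ^residue≈1⇔c∣ x) ∘ x-y≈0⇒x≈y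
      uᶜ-1≈0 : u ^ c - 1# ≈ 0#
      uᶜ-1≈0 = trans (+-congʳ (trans (^-assocʳ ζ (residue x) c) (ζ^[n+q*c]≈ζ^n 0 (residue x))))
                     (-‿inverseʳ 1#)

module FourierDedekindSum {κ ℓ} (K : CharZeroField κ ℓ) (ζ : CharZeroField.Carrier K) (c′ : ℕ)
                          (ζ-primitive : IsPrimitiveRoot K ζ (suc c′))
                          (e : ℕ) (c⊥e : Coprime (suc c′) e) where
  open CharZeroField K
  open FieldProperties K
  open FiniteSums K
  open RootOfUnity K ζ c′ ζ-primitive
  open import Relation.Binary.Reasoning.Setoid setoid
  open IntegerCoefficientSolver cring using (solve; _:=_; _:+_; _:*_; _:-_; con)

  Sₑ : ℤ → Carrier
  Sₑ = S K ζ e c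

  1-ζ^je≉0 : ∀ {j} → 0 < j → j < c → ¬ 1# - ζ ^ (j ℕ.* e) ≈ 0#
  1-ζ^je≉0 {j} 0<j j<c 1-ζ^je≈0 = ℕ.<⇒≱ j<c (ℕ.∣⇒≤ ⦃ ℕ.>-nonZero 0<j ⦄ c∣j)
    where
    c∣j : c ℕ.∣ j
    c∣j = coprime-divisor c⊥e (≡.subst (c ℕ.∣_) (ℕ.*-comm j e)
            (ζ^m≈1⇒c∣m (j ℕ.* e) (sym (x-y≈0⇒x≈y 1-ζ^je≈0))))

  Sₑ-cong : ∀ {x y} → x ≡ y mod c → Sₑ x ≈ Sₑ y
  Sₑ-cong x≡y = *-congˡ (sumFrom-cong 1 c′ λ j _ _ → *-congʳ (zpow-cong (≡-mod-*ˡ (+ j) x≡y)))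

  shifted-term : ∀ n {j} → 0 < j → j < c →
    zpow K ζ (+ j ℤ.* (n ℤ.+ + e)) * inv (1# - ζ ^ (j ℕ.* e))
      ≈ zpow K ζ (+ j ℤ.* n) * inv (1# - ζ ^ (j ℕ.* e)) - zpow K ζ (+ j ℤ.* n)
  shifted-term n {j} 0<j j<c = begin
    zpow K ζ (+ j ℤ.* (n ℤ.+ + e)) * I       ≡⟨ ≡.cong (λ y → zpow K ζ y * I) jn+je ⟩
    zpow K ζ (+ j ℤ.* n ℤ.+ + (j ℕ.* e)) * I ≈⟨ *-congʳ (zpow-+ (+ j ℤ.* n) (j ℕ.* e)) ⟩
    (A * w) * I
      ≈⟨ solve 3 (λ A w I → (A :* w) :* I := A :* I :- A :* ((con 1ℤ :- w) :* I)) refl A w I ⟩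
    A * I - A * ((1# - w) * I)               ≈⟨ +-congˡ (-‿cong (*-congˡ (inv-right (1# - w) 1-w≉0))) ⟩
    A * I - A * 1#                           ≈⟨ +-congˡ (-‿cong (*-identityʳ A)) ⟩
    A * I - A                                ∎
    where
    A w I : Carrier
    A = zpow K ζ (+ j ℤ.* n)
    w = ζ ^ (j ℕ.* e)
    I = inv (1# - w)
    1-w≉0 : ¬ 1# - w ≈ 0#
    1-w≉0 = 1-ζ^je≉0 0<j j<c
    jn+je : + j ℤ.* (n ℤ.+ + e) ≡ + j ℤ.* n ℤ.+ + (j ℕ.* e)
    jn+je = ≡.trans (ℤ.*-distribˡ-+ (+ j) n (+ e)) (≡.cong (ℤ._+_ (+ j ℤ.* n)) (≡.sym (ℤ.pos-* j e)))

  nontrivial-character-sum : ∀ n → sumFrom K 1 c′ (λ j → zpow K ζ (+ j ℤ.* n)) ≈ ι K c * δdiv K n c - 1#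
  nontrivial-character-sum n = begin
    s               ≈⟨ solve 1 (λ s → s := (con 1ℤ :+ s) :- con 1ℤ) refl s ⟩
    (1# + s) - 1#   ≈⟨ +-congʳ (character-sum n) ⟩
    ι K c * δdiv K n c - 1# ∎
    where
    s : Carrier
    s = sumFrom K 1 c′ (λ j → zpow K ζ (+ j ℤ.* n))

  Sₑ-+e : ∀ n → Sₑ (n ℤ.+ + e) ≈ (Sₑ n - δdiv K n c) + inv (ι K c)
  Sₑ-+e n = begin
    c⁻¹ * sumFrom K 1 c′ (λ j → zpow K ζ (+ j ℤ.* (n ℤ.+ + e)) * I j)
      ≈⟨ *-congˡ (sumFrom-cong 1 c′ λ j 0<j j<c → shifted-term n 0<j j<c) ⟩
    c⁻¹ * sumFrom K 1 c′ (λ j → A j * I j - A j)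
      ≈⟨ *-congˡ (sumFrom-distrib-minus 1 c′ _ A) ⟩
    c⁻¹ * (T - sumFrom K 1 c′ A)
      ≈⟨ *-congˡ (+-congˡ (-‿cong (nontrivial-character-sum n))) ⟩
    c⁻¹ * (T - (ι K c * δ - 1#))
      ≈⟨ solve 4 (λ c⁻¹ T c δ → c⁻¹ :* (T :- (c :* δ :- con 1ℤ)) := (c⁻¹ :* T :- (c :* c⁻¹) :* δ) :+ c⁻¹)
               refl c⁻¹ T (ι K c) δ ⟩
    (c⁻¹ * T - (ι K c * c⁻¹) * δ) + c⁻¹
      ≈⟨ +-congʳ (+-congˡ (-‿cong (trans (*-congʳ c*c⁻¹≈1) (*-identityˡ δ)))) ⟩
    (c⁻¹ * T - δ) + c⁻¹ ∎
    where
    c⁻¹ δ T : Carrier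
    A I : ℕ → Carrier
    c⁻¹ = inv (ι K c)
    δ = δdiv K n c
    A j = zpow K ζ (+ j ℤ.* n)
    I j = inv (1# - ζ ^ (j ℕ.* e))
    T = sumFrom K 1 c′ (λ j → A j * I j)
    c*c⁻¹≈1 : ι K c * c⁻¹ ≈ 1#
    c*c⁻¹≈1 = inv-right (ι K c) (char0 c λ ())

  private
    n+[1+k]e≡[n+ke]+e : ∀ n k e → n ℤ.+ (1ℤ ℤ.+ k) ℤ.* e ≡ (n ℤ.+ k ℤ.* e) ℤ.+ e
    n+[1+k]e≡[n+ke]+e = ℤ-Solver.solve-∀

  Sₑ-+k*e : ∀ n k → Sₑ (n ℤ.+ + k ℤ.* + e)
                    ≈ (Sₑ n - sumFrom K 0 k (λ j → δdiv K (n ℤ.+ + j ℤ.* + e) c)) + ι K k * inv (ι K c)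
  Sₑ-+k*e n zero = begin
    Sₑ (n ℤ.+ 0ℤ)           ≡⟨ ≡.cong Sₑ (ℤ.+-identityʳ n) ⟩
    Sₑ n
      ≈⟨ solve 2 (λ s c⁻¹ → s := (s :- con 0ℤ) :+ con 0ℤ :* c⁻¹) refl (Sₑ n) (inv (ι K c)) ⟩
    (Sₑ n - 0#) + 0# * inv (ι K c) ∎
  Sₑ-+k*e n (suc k) = begin
    Sₑ (n ℤ.+ + suc k ℤ.* + e)           ≡⟨ ≡.cong Sₑ (n+[1+k]e≡[n+ke]+e n (+ k) (+ e)) ⟩
    Sₑ ((n ℤ.+ + k ℤ.* + e) ℤ.+ + e)     ≈⟨ Sₑ-+e (n ℤ.+ + k ℤ.* + e) ⟩
    (Sₑ (n ℤ.+ + k ℤ.* + e) - f k) + c⁻¹ ≈⟨ +-congʳ (+-congʳ (Sₑ-+k*e n k)) ⟩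
    (((Sₑ n - Σ) + ι K k * c⁻¹) - f k) + c⁻¹
      ≈⟨ solve 5 (λ s Σ k f c⁻¹ → (((s :- Σ) :+ k :* c⁻¹) :- f) :+ c⁻¹ := (s :- (Σ :+ f)) :+ (con 1ℤ :+ k) :* c⁻¹)
               refl (Sₑ n) Σ (ι K k) (f k) c⁻¹ ⟩
    (Sₑ n - (Σ + f k)) + ι K (suc k) * c⁻¹  ≈⟨ +-congʳ (+-congˡ (-‿cong (sumFrom-suc 0 k f))) ⟨
    (Sₑ n - sumFrom K 0 (suc k) f) + ι K (suc k) * c⁻¹ ∎
    where
    f : ℕ → Carrier
    c⁻¹ Σ : Carrier
    f j = δdiv K (n ℤ.+ + j ℤ.* + e) c
    c⁻¹ = inv (ι K c)
    Σ = sumFrom K 0 k f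

lemma34 : ∀ {c ℓ : Level} (K : CharZeroField c ℓ) (a b k : ℕ)
          → 0 < a → 0 < b → Coprime a b → 0 < k
          → (ζa ζb : CharZeroField.Carrier K)
          → IsPrimitiveRoot K ζa a → IsPrimitiveRoot K ζb b
          → (t : ℤ)
          → let open CharZeroField K in
            R K ζa ζb a b (t ℤ.+ (+ k) ℤ.* (+ a ℤ.+ + b))
              ≈ ((R K ζa ζb a b t
                  - sumFrom K 0 k (λ j → δdiv K (t ℤ.+ (+ j) ℤ.* (+ b)) a
                                         + δdiv K (t ℤ.+ (+ j) ℤ.* (+ a)) b))
                 + ι K k * inv (ι K a))
                + ι K k * inv (ι K b)
lemma34 K (suc a′) (suc b′) k _ _ a⊥b _ ζa ζb ζa-primitive ζb-primitive t = begin
  Sᵃ t′ + Sᵇ t′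
    ≈⟨ +-cong (A.Sₑ-cong (x+k[c+y]≡x+ky t (+ k) (+ b))) (B.Sₑ-cong t′≡t+ka) ⟩
  Sᵃ (t ℤ.+ + k ℤ.* + b) + Sᵇ (t ℤ.+ + k ℤ.* + a)
    ≈⟨ +-cong (A.Sₑ-+k*e t k) (B.Sₑ-+k*e t k) ⟩
  ((Sᵃ t - Σᵃ) + k/a) + ((Sᵇ t - Σᵇ) + k/b)
    ≈⟨ solve 6 (λ x y Σ Σ′ p q → ((x :- Σ) :+ p) :+ ((y :- Σ′) :+ q) := (((x :+ y) :- (Σ :+ Σ′)) :+ p) :+ q)
             refl (Sᵃ t) (Sᵇ t) Σᵃ Σᵇ k/a k/b ⟩
  (((Sᵃ t + Sᵇ t) - (Σᵃ + Σᵇ)) + k/a) + k/b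
    ≈⟨ +-congʳ (+-congʳ (+-congˡ (-‿cong (sumFrom-distrib-+ 0 k δᵃ δᵇ)))) ⟨
  (((Sᵃ t + Sᵇ t) - sumFrom K 0 k (λ j → δᵃ j + δᵇ j)) + k/a) + k/b ∎
  where
  open CharZeroField K
  open FiniteSums K
  open IntegerCoefficientSolver cring using (solve; _:=_; _:+_; _:-_)
  open import Relation.Binary.Reasoning.Setoid setoid
  a b : ℕ
  a = suc a′
  b = suc b′
  module A = FourierDedekindSum K ζa a′ ζa-primitive b a⊥b
  module B = FourierDedekindSum K ζb b′ ζb-primitive a (Coprimality.sym a⊥b)
  t′ : ℤ
  t′ = t ℤ.+ + k ℤ.* (+ a ℤ.+ + b)
  t′≡t+ka : t′ ≡ t ℤ.+ + k ℤ.* + a mod b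
  t′≡t+ka = ≡.subst (λ s → t ℤ.+ + k ℤ.* s ≡ t ℤ.+ + k ℤ.* + a mod b) (ℤ.+-comm (+ b) (+ a))
                    (x+k[c+y]≡x+ky t (+ k) (+ a))
  Sᵃ Sᵇ : ℤ → Carrier
  Sᵃ = A.Sₑ
  Sᵇ = B.Sₑ
  δᵃ δᵇ : ℕ → Carrier
  δᵃ j = δdiv K (t ℤ.+ + j ℤ.* + b) a
  δᵇ j = δdiv K (t ℤ.+ + j ℤ.* + a) b
  Σᵃ Σᵇ k/a k/b : Carrier
  Σᵃ = sumFrom K 0 k δᵃ
  Σᵇ = sumFrom K 0 k δᵇ
  k/a = ι K k * inv (ι K a)
  k/b = ι K k * inv (ι K b)
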